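{- For every integer $n\ge 1$ and every string $u$ of length $n$, the sum of the exponents of all runs in $u$ is less than $4.1\,n$.
   Context: For a word $u=u_1\cdots u_m$, $u[i..j]=u_i\cdots u_j$. The shortest period of a word $x$ of length $m$ is the smallest positive integer $p$ with $x_i=x_{i+p}$ for all $1\le i\le m-p$. A run in $u$ is an interval $[i..j]$ such that the shortest period $p$ of $u[i..j]$ satisfies $2p\le j-i+1$ and (whenever the indices exist) $u[i-1]\ne u[i+p-1]$ and $u[j-p+1]\ne u[j+1]$. The exponent of such a run is $(j-i+1)/p$. Strings are over an arbitrary finite alphabet. -}

module Defs where

open import Data.Nat using (ℕ; zero; suc; _+_; _∸_; _*_; _≤_; _<_)
open import Data.Fin using (Fin; fromℕ<)
open import Data.Vec using (Vec; lookup)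
open import Data.Product using (Σ; Σ-syntax; _×_; _,_)
open import Data.List using (List; foldr)
open import Data.Integer using (+_)
open import Data.Rational using (ℚ; 0ℚ; _/_) renaming (_+_ to _+ℚ_)
open import Relation.Binary.PropositionalEquality using (_≡_)
open import Relation.Nullary using (¬_)

-- Strings of length n over the finite alphabet Fin k; positions are 0-based.
-- (Position t of the paper's 1-based indexing is position t ∸ 1 here.)

CharEq : ∀ {k n} → Vec (Fin k) n → ℕ → ℕ → Set
CharEq {n = n} u a b =
  Σ[ a<n ∈ a < n ] Σ[ b<n ∈ b < n ] lookup u (fromℕ< a<n) ≡ lookup u (fromℕ< b<n)

IsPeriod : ∀ {k n} → Vec (Fin k) n → ℕ → ℕ → ℕ → Set
IsPeriod u i j p = 1 ≤ p × (∀ t → i ≤ t → t + p ≤ j → CharEq u t (t + p))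

IsShortestPeriod : ∀ {k n} → Vec (Fin k) n → ℕ → ℕ → ℕ → Set
IsShortestPeriod u i j p = IsPeriod u i j p × (∀ q → 1 ≤ q → q < p → ¬ IsPeriod u i j q)

IsRunWithPeriod : ∀ {k n} → Vec (Fin k) n → ℕ → ℕ → ℕ → Set
IsRunWithPeriod {n = n} u i j p =
  i ≤ j × j < n
  × IsShortestPeriod u i j p
  × 2 * p ≤ suc j ∸ i
  × (1 ≤ i → ¬ CharEq u (i ∸ 1) (i ∸ 1 + p))
  × (suc j < n → ¬ CharEq u (suc j ∸ p) (suc j))

exponent : ℕ × ℕ × ℕ → ℚ
exponent (i , j , zero) = 0ℚ
exponent (i , j , suc q) = (+ (suc j ∸ i)) / suc q

sumℚ : List ℚ → ℚ
sumℚ = foldr _+ℚ_ 0ℚ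

module Submission where

-- Order the letters, for each run [i..j] of period p, so that the letter after the
-- run is smaller than the letter one period earlier, and call k > i a root position of the run if
-- the factor [k, k+p) lies in the run and is a Lyndon word for that order. Inside the run the
-- string is the periodic extension of its primitive period, whose least rotation is Lyndon; its
-- translates by multiples of p give ⌊D/p⌋ ≥ 1 root positions when the run has length a + D with
-- a ≤ p ≤ D, so the exponent is at most three times the number of roots. Two different runs never
-- share a root position: with equal periods they would overlap on a whole period, with different
-- periods the shorter root would extend to the longer Lyndon word or clash with its order. The
-- root positions of all runs are therefore distinct positions of the string, and the exponents
-- sum to at most 3n < 4.1n.

open import Data.Fin using (Fin)
open import Data.Nat using (ℕ)
open import Data.Vec using (Vec)

module Lyndon where

  open import Data.Bool using (Bool; true; false; not)
  open import Data.Empty using (⊥-elim)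
  open import Data.Nat hiding (less; equal; greater)
  open import Data.Nat.DivMod
  open import Data.Nat.Properties
  open import Algebra.Properties.CommutativeSemigroup +-commutativeSemigroup using (xy∙z≈xz∙y)
  open import Data.Product using (∃; _×_; _,_)
  open import Data.Sum using (_⊎_; inj₁; inj₂; [_,_])
  open import Function using (id; _∘_; case_of_)
  open import Relation.Binary.Definitions
    using (Irreflexive; Asymmetric; Transitive; Trichotomous; tri<; tri≈; tri>)
  open import Relation.Binary.PropositionalEquality hiding ([_])
  open import Relation.Nullary using (¬_; yes; no)
  open import Relation.Nullary.Reflects using (ofʸ; ofⁿ)

  infix 4 _<[_]_

  _<[_]_ : ℕ → Bool → ℕ → Set
  a <[ true ]  b = a < b
  a <[ false ] b = b < a

  <[]-irrefl : ∀ o → Irreflexive _≡_ (_<[ o ]_)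
  <[]-irrefl true  a≡b = <-irrefl a≡b
  <[]-irrefl false a≡b = <-irrefl (sym a≡b)

  <[]-asym : ∀ o → Asymmetric (_<[ o ]_)
  <[]-asym true  = <-asym
  <[]-asym false = <-asym

  <[]-trans : ∀ o → Transitive (_<[ o ]_)
  <[]-trans true  a<b b<c = <-trans a<b b<c
  <[]-trans false b<a c<b = <-trans c<b b<a

  <[]-cmp : ∀ o → Trichotomous _≡_ (_<[ o ]_)
  <[]-cmp true = <-cmp
  <[]-cmp false a b with <-cmp a b
  ... | tri< a<b a≢b b≮a = tri> b≮a a≢b a<b
  ... | tri≈ a≮b a≡b b≮a = tri≈ b≮a a≡b a≮b
  ... | tri> a≮b a≢b b<a = tri< b<a a≢b a≮b

  <[not]⇒> : ∀ o {a b} → a <[ not o ] b → b <[ o ] a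
  <[not]⇒> true  b<a = b<a
  <[not]⇒> false a<b = a<b

  orientation : ℕ → ℕ → Bool
  orientation a b = a <ᵇ b

  orientation-correct : ∀ {a b} → a ≢ b → a <[ orientation a b ] b
  orientation-correct {a} {b} a≢b with a <ᵇ b | <ᵇ-reflects-< a b
  ... | true  | ofʸ a<b = a<b
  ... | false | ofⁿ a≮b = ≤∧≢⇒< (≮⇒≥ a≮b) (a≢b ∘ sym)

  record Agree (F : ℕ → ℕ) (a b m : ℕ) : Set where
    constructor agree
    field agree-at : ∀ t → t < m → F (a + t) ≡ F (b + t)

  record LexLess (o : Bool) (F : ℕ → ℕ) (a b m : ℕ) : Set where
    constructor lex
    field
      mismatch     : ℕ
      mismatch<m   : mismatch < m
      agree-before : ∀ t → t < mismatch → F (a + t) ≡ F (b + t)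
      less-at      : F (a + mismatch) <[ o ] F (b + mismatch)

  LexLeq : Bool → (ℕ → ℕ) → ℕ → ℕ → ℕ → Set
  LexLeq o F a b m = LexLess o F a b m ⊎ Agree F a b m

  Agree-refl : ∀ F a m → Agree F a a m
  Agree-refl F a m = agree λ _ _ → refl

  Agree-sym : ∀ {F a b m} → Agree F a b m → Agree F b a m
  Agree-sym (agree eq) = agree λ t t<m → sym (eq t t<m)

  lex-compare : ∀ o F a b m → LexLess o F a b m ⊎ Agree F a b m ⊎ LexLess o F b a m
  lex-compare o F a b zero = inj₂ (inj₁ (agree λ _ ()))
  lex-compare o F a b (suc m) with lex-compare o F a b m
  ... | inj₁ (lex e e<m ag l)        = inj₁ (lex e (m<n⇒m<1+n e<m) ag l)
  ... | inj₂ (inj₂ (lex e e<m ag l)) = inj₂ (inj₂ (lex e (m<n⇒m<1+n e<m) ag l))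
  ... | inj₂ (inj₁ (agree eq)) with <[]-cmp o (F (a + m)) (F (b + m))
  ...   | tri< l _ _    = inj₁ (lex m ≤-refl eq l)
  ...   | tri> _ _ l    = inj₂ (inj₂ (lex m ≤-refl (λ t t<m → sym (eq t t<m)) l))
  ...   | tri≈ _ eqₘ _ = inj₂ (inj₁ (agree extend))
    where
    extend : ∀ t → t < suc m → F (a + t) ≡ F (b + t)
    extend t t<1+m with m≤n⇒m<n∨m≡n (≤-pred t<1+m)
    ... | inj₁ t<m  = eq t t<m
    ... | inj₂ refl = eqₘ

  LexLess-asym : ∀ o {F a b m m′} → LexLess o F a b m → ¬ LexLess o F b a m′
  LexLess-asym o (lex e _ ag l) (lex e′ _ ag′ l′) with <-cmp e e′
  ... | tri< e<e′ _ _ = <[]-irrefl o (sym (ag′ e e<e′)) l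
  ... | tri≈ _ refl _ = <[]-asym o l l′
  ... | tri> _ _ e′<e = <[]-irrefl o (sym (ag e′ e′<e)) l′

  LexLess⇒¬LexLeq : ∀ o {F a b m} → LexLess o F a b m → ¬ LexLeq o F b a m
  LexLess⇒¬LexLeq o less (inj₁ greater)             = LexLess-asym o less greater
  LexLess⇒¬LexLeq o (lex e e<m _ l) (inj₂ (agree eq)) = <[]-irrefl o (sym (eq e e<m)) l

  LexLess-trans : ∀ o {F a b c m} → LexLess o F a b m → LexLess o F b c m → LexLess o F a c m
  LexLess-trans o (lex e e<m ag l) (lex e′ e′<m ag′ l′) with <-cmp e e′
  ... | tri< e<e′ _ _ =
    lex e e<m (λ t t<e → trans (ag t t<e) (ag′ t (<-trans t<e e<e′))) (subst₂ (_<[ o ]_) refl (ag′ e e<e′) l)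
  ... | tri≈ _ refl _ =
    lex e e<m (λ t t<e → trans (ag t t<e) (ag′ t t<e)) (<[]-trans o l l′)
  ... | tri> _ _ e′<e =
    lex e′ e′<m (λ t t<e′ → trans (ag t (<-trans t<e′ e′<e)) (ag′ t t<e′))
        (subst₂ (_<[ o ]_) (sym (ag e′ e′<e)) refl l′)

  LexLess-respʳ-Agree : ∀ o {F a b c m} → LexLess o F a b m → Agree F b c m → LexLess o F a c m
  LexLess-respʳ-Agree o (lex e e<m ag l) (agree eq) =
    lex e e<m (λ t t<e → trans (ag t t<e) (eq t (<-trans t<e e<m))) (subst₂ (_<[ o ]_) refl (eq e e<m) l)

  LexLeq-respʳ-Agree : ∀ o {F a b c m} → LexLeq o F a b m → Agree F b c m → LexLeq o F a c m
  LexLeq-respʳ-Agree o (inj₁ less) same = inj₁ (LexLess-respʳ-Agree o less same)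
  LexLeq-respʳ-Agree o (inj₂ (agree eq)) (agree eq′) = inj₂ (agree λ t t<m → trans (eq t t<m) (eq′ t t<m))

  LexLess-LexLeq-trans : ∀ o {F a b c m} → LexLess o F a b m → LexLeq o F b c m → LexLess o F a c m
  LexLess-LexLeq-trans o less (inj₁ less′) = LexLess-trans o less less′
  LexLess-LexLeq-trans o less (inj₂ same)  = LexLess-respʳ-Agree o less same

  LexLess-truncate : ∀ o {F a b m} → LexLess o F a b m → ∀ m′ → LexLeq o F a b m′
  LexLess-truncate o (lex e _ ag l) m′ with e <? m′
  ... | yes e<m′ = inj₁ (lex e e<m′ ag l)
  ... | no  e≮m′ = inj₂ (agree λ t t<m′ → ag t (<-≤-trans t<m′ (≮⇒≥ e≮m′)))

  LexLess-drop : ∀ o {F a b} g m → LexLess o F a b (g + m) → Agree F a b g → LexLess o F (a + g) (b + g) m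
  LexLess-drop o {F} {a} {b} g m (lex e e<g+m ag l) (agree eq) with g ≤? e
  ... | no  g≰e = ⊥-elim (<[]-irrefl o (eq e (≰⇒> g≰e)) l)
  ... | yes g≤e with m≤n⇒∃[o]m+o≡n g≤e
  ...   | e′ , refl = lex e′ (+-cancelˡ-< g e′ m e<g+m) shifted (subst₂ (_<[ o ]_) (assoc a) (assoc b) l)
    where
    assoc : ∀ x {t} → F (x + (g + t)) ≡ F (x + g + t)
    assoc x {t} = cong F (sym (+-assoc x g t))
    shifted : ∀ t → t < e′ → F (a + g + t) ≡ F (b + g + t)
    shifted t t<e′ = subst₂ _≡_ (assoc a) (assoc b) (ag (g + t) (+-monoʳ-< g t<e′))

  LexLess-transport : ∀ o {F G a b a′ b′ m}
    → (∀ t → t < m → F (a + t) ≡ G (a′ + t)) → (∀ t → t < m → F (b + t) ≡ G (b′ + t))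
    → LexLess o F a b m → LexLess o G a′ b′ m
  LexLess-transport o ha hb (lex e e<m ag l) =
    lex e e<m (λ t t<e → trans (sym (ha t (<-trans t<e e<m))) (trans (ag t t<e) (hb t (<-trans t<e e<m))))
        (subst₂ (_<[ o ]_) (ha e e<m) (hb e e<m) l)

  least-window : ∀ o F m ℓ → ∃ λ a → 1 ≤ a × a ≤ suc m × (∀ x → 1 ≤ x → x ≤ suc m → LexLeq o F a x ℓ)
  least-window o F zero ℓ =
    1 , ≤-refl , ≤-refl ,
    λ x 1≤x x≤1 → inj₂ (subst (λ y → Agree F 1 y ℓ) (≤-antisym 1≤x x≤1) (Agree-refl F 1 ℓ))
  least-window o F (suc m) ℓ with least-window o F m ℓ
  ... | a , 1≤a , a≤1+m , least with lex-compare o F (2 + m) a ℓ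
  ...   | inj₁ new<a = 2 + m , s≤s z≤n , ≤-refl , λ x 1≤x x≤2+m → case m≤n⇒m<n∨m≡n x≤2+m of λ where
            (inj₁ x<2+m) → inj₁ (LexLess-LexLeq-trans o new<a (least x 1≤x (≤-pred x<2+m)))
            (inj₂ refl)  → inj₂ (Agree-refl F x ℓ)
  ...   | inj₂ a≤new = a , 1≤a , m≤n⇒m≤1+n a≤1+m , λ x 1≤x x≤2+m → case m≤n⇒m<n∨m≡n x≤2+m of λ where
            (inj₁ x<2+m) → least x 1≤x (≤-pred x<2+m)
            (inj₂ refl)  → [ inj₂ ∘ Agree-sym , inj₁ ] a≤new

  -- Each proper suffix is compared on its own length; strictness there excludes borders, so this
  -- is the usual notion of a Lyndon word.
  Lyndon : Bool → (ℕ → ℕ) → ℕ → ℕ → Set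
  Lyndon o F k m = ∀ d g → 1 ≤ d → 1 ≤ g → d + g ≡ m → LexLess o F k (k + d) g

  Lyndon-transport : ∀ o {F G k k′ m} → (∀ t → t < m → F (k + t) ≡ G (k′ + t))
    → Lyndon o F k m → Lyndon o G k′ m
  Lyndon-transport o {F} {G} {k} {k′} {m} F≈G lyndon d g 1≤d 1≤g d+g≡m =
    LexLess-transport o (λ t t<g → F≈G t (<-≤-trans t<g g≤m)) suffix (lyndon d g 1≤d 1≤g d+g≡m)
    where
    g≤m : g ≤ m
    g≤m = subst (g ≤_) d+g≡m (m≤n+m g d)
    suffix : ∀ t → t < g → F (k + d + t) ≡ G (k′ + d + t)
    suffix t t<g = begin
      F (k + d + t)    ≡⟨ cong F (+-assoc k d t) ⟩
      F (k + (d + t))  ≡⟨ F≈G (d + t) (subst (d + t <_) d+g≡m (+-monoʳ-< d t<g)) ⟩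
      G (k′ + (d + t)) ≡⟨ cong G (+-assoc k′ d t) ⟨
      G (k′ + d + t)   ∎
      where open ≡-Reasoning

  Lyndon⇒first<last : ∀ o {F k} m → Lyndon o F k (2 + m) → F k <[ o ] F (k + suc m)
  Lyndon⇒first<last o {F} {k} m lyndon with lyndon (suc m) 1 (s≤s z≤n) ≤-refl (+-comm (suc m) 1)
  ... | lex zero _ _ l = subst₂ (_<[ o ]_) (cong F (+-identityʳ k)) (cong F (+-identityʳ (k + suc m))) l
  ... | lex (suc _) (s≤s ()) _ _

  Lyndon⇒first-rise : ∀ o {F k} m → Lyndon o F k (2 + m)
    → ∃ λ g → (∀ t → t < g → F (k + t) ≡ F k) × F k <[ o ] F (k + g)
  Lyndon⇒first-rise o {F} {k} m lyndon with lyndon 1 (suc m) ≤-refl (s≤s z≤n) refl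
  ... | lex e _ ag l =
    suc e , (λ t t<1+e → flat t (≤-pred t<1+e)) , subst₂ (_<[ o ]_) (flat e ≤-refl) (cong F (+-assoc k 1 e)) l
    where
    flat : ∀ t → t ≤ e → F (k + t) ≡ F k
    flat zero    _     = cong F (+-identityʳ k)
    flat (suc t) t<e = trans (cong F (sym (+-assoc k 1 t))) (trans (sym (ag t t<e)) (flat t (<⇒≤ t<e)))

  Lyndon-unique-order : ∀ o {F k} m m′ → Lyndon o F k (2 + m) → ¬ Lyndon (not o) F k (2 + m′)
  Lyndon-unique-order o m m′ lyndon lyndon′
    with Lyndon⇒first-rise o m lyndon | Lyndon⇒first-rise (not o) m′ lyndon′
  ... | g , flat , rise | g′ , flat′ , rise′ with <-cmp g g′
  ... | tri< g<g′ _ _ = <[]-irrefl o (sym (flat′ g g<g′)) rise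
  ... | tri≈ _ refl _ = <[]-asym o rise (<[not]⇒> o rise′)
  ... | tri> _ _ g′<g = <[]-irrefl (not o) (sym (flat g′ g′<g)) rise′

  cycle : (ℕ → ℕ) → (p : ℕ) → .{{NonZero p}} → ℕ → ℕ
  cycle w p t = w (t % p)

  module _ (w : ℕ → ℕ) (p : ℕ) .{{_ : NonZero p}} where

    private
      ω : ℕ → ℕ
      ω = cycle w p

    cycle-periodic : ∀ t c → ω (t + c * p) ≡ ω t
    cycle-periodic t c = cong w ([m+kn]%n≡m%n t c p)

    cycle-periodic₁ : ∀ t → ω (t + p) ≡ ω t
    cycle-periodic₁ t = cong w ([m+n]%n≡m%n t p)

    cycle-Agree⇒≡ : ∀ {a b} → Agree ω a b p → ∀ s → ω (a + s) ≡ ω (b + s)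
    cycle-Agree⇒≡ {a} {b} (agree eq) s = begin
      ω (a + s)       ≡⟨ reduce a ⟩
      ω (a + s % p)   ≡⟨ eq (s % p) (m%n<n s p) ⟩
      ω (b + s % p)   ≡⟨ reduce b ⟨
      ω (b + s)       ∎
      where
      open ≡-Reasoning
      reduce : ∀ x → ω (x + s) ≡ ω (x + s % p)
      reduce x = begin
        ω (x + s)                  ≡⟨ cong (λ y → ω (x + y)) (m≡m%n+[m/n]*n s p) ⟩
        ω (x + (s % p + s / p * p)) ≡⟨ cong ω (+-assoc x (s % p) (s / p * p)) ⟨
        ω (x + s % p + s / p * p)  ≡⟨ cycle-periodic (x + s % p) (s / p) ⟩
        ω (x + s % p)              ∎

    -- Shifting t by a·p ≥ a lands in the range where agreement from a holds.
    cycle-Agree⇒shift : ∀ {a g} → Agree ω a (a + g) p → ∀ t → ω t ≡ ω (t + g)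
    cycle-Agree⇒shift {a} {g} same t = begin
      ω t                   ≡⟨ cycle-periodic t a ⟨
      ω (t + a * p)         ≡⟨ cong ω (m+[n∸m]≡n a≤t+ap) ⟨
      ω (a + s)             ≡⟨ cycle-Agree⇒≡ same s ⟩
      ω (a + g + s)         ≡⟨ cong ω eq ⟩
      ω (t + g + a * p)     ≡⟨ cycle-periodic (t + g) a ⟩
      ω (t + g)             ∎
      where
      open ≡-Reasoning
      s = t + a * p ∸ a
      a≤t+ap : a ≤ t + a * p
      a≤t+ap = ≤-trans (m≤m*n a p) (m≤n+m (a * p) t)
      eq : a + g + s ≡ t + g + a * p
      eq = begin
        a + g + s     ≡⟨ xy∙z≈xz∙y a g s ⟩
        a + s + g     ≡⟨ cong (_+ g) (m+[n∸m]≡n a≤t+ap) ⟩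
        t + a * p + g ≡⟨ xy∙z≈xz∙y t (a * p) g ⟩
        t + g + a * p ∎

  -- The least rotation of a primitive word is strictly least, hence Lyndon.
  primitive-cycle-Lyndon-rotation : ∀ o w q
    → (∀ g → 1 ≤ g → g < suc q → ¬ (∀ t → cycle w (suc q) t ≡ cycle w (suc q) (t + g)))
    → ∃ λ a → 1 ≤ a × a ≤ suc q × Lyndon o (cycle w (suc q)) a (suc q)
  primitive-cycle-Lyndon-rotation o w q isPrimitive with least-window o (cycle w (suc q)) q (suc q)
  ... | a , 1≤a , a≤p , least = a , 1≤a , a≤p , lyndon
    where
    p = suc q
    ω = cycle w p

    least-rotation : ∀ g → g < p → LexLeq o ω a (a + g) p
    least-rotation g g<p with a + g ≤? p
    ... | yes a+g≤p = least (a + g) (≤-trans 1≤a (m≤m+n a g)) a+g≤p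
    ... | no  a+g≰p = LexLeq-respʳ-Agree o (least y 1≤y y≤p) (agree λ t _ → wrap t)
      where
      p<a+g = ≰⇒> a+g≰p
      y = a + g ∸ p
      1≤y : 1 ≤ y
      1≤y = m<n⇒0<n∸m p<a+g
      y≤p : y ≤ p
      y≤p = m≤n+o⇒m∸n≤o (a + g) p (<⇒≤ (+-mono-≤-< a≤p g<p))
      wrap : ∀ t → ω (y + t) ≡ ω (a + g + t)
      wrap t = begin
        ω (y + t)       ≡⟨ cycle-periodic₁ w p (y + t) ⟨
        ω (y + t + p)   ≡⟨ cong ω (xy∙z≈xz∙y y t p) ⟩
        ω (y + p + t)   ≡⟨ cong (λ x → ω (x + t)) (m∸n+n≡m (<⇒≤ p<a+g)) ⟩
        ω (a + g + t)   ∎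
        where open ≡-Reasoning

    least-rotation-strict : ∀ g → 1 ≤ g → g < p → LexLess o ω a (a + g) p
    least-rotation-strict g 1≤g g<p with least-rotation g g<p
    ... | inj₁ less = less
    ... | inj₂ same = ⊥-elim (isPrimitive g 1≤g g<p (cycle-Agree⇒shift w p same))

    -- A mismatch beyond the suffix length g would make the rotation by g smaller than the least one.
    lyndon : Lyndon o ω a p
    lyndon d g 1≤d 1≤g d+g≡p = [ id , ⊥-elim ∘ contradiction ] (LexLess-truncate o d-rotation g)
      where
      d-rotation : LexLess o ω a (a + d) (g + d)
      d-rotation = subst (LexLess o ω a (a + d)) (trans (sym d+g≡p) (+-comm d g))
                     (least-rotation-strict d 1≤d (subst (d <_) d+g≡p (m<m+n d 1≤g)))
      g-rotation : LexLess o ω a (a + g) p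
      g-rotation = least-rotation-strict g 1≤g (subst (g <_) (trans (+-comm g d) d+g≡p) (m<m+n g 1≤d))
      wrap : ∀ t → ω (a + d + g + t) ≡ ω (a + t)
      wrap t = begin
        ω (a + d + g + t) ≡⟨ cong (λ x → ω (x + t)) (trans (+-assoc a d g) (cong (a +_) d+g≡p)) ⟩
        ω (a + p + t)     ≡⟨ cong ω (xy∙z≈xz∙y a p t) ⟩
        ω (a + t + p)     ≡⟨ cycle-periodic₁ w p (a + t) ⟩
        ω (a + t)         ∎
        where open ≡-Reasoning
      contradiction : ¬ Agree ω a (a + d) g
      contradiction same = LexLess⇒¬LexLeq o g-rotation-smaller (LexLess-truncate o g-rotation d)
        where
        g-rotation-smaller : LexLess o ω (a + g) a d
        g-rotation-smaller = LexLess-respʳ-Agree o (LexLess-drop o g d d-rotation same) (agree λ t _ → wrap t)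


module Bounds where

  open import Data.Integer as ℤ using (+≤+; +<+)
  import Data.Integer.Properties as ℤ
  open import Data.Integer.Tactic.RingSolver using () renaming (solve-∀ to ℤ-solve-∀)
  open import Data.List using (List; []; _∷_; length; filter)
  open import Data.List.Properties using (filter-all; filter-accept; filter-reject)
  open import Data.List.Relation.Unary.All as All using (All; []; _∷_)
  open import Data.List.Relation.Unary.All.Properties using (all-filter) renaming (filter⁺ to All-filter⁺)
  open import Data.List.Relation.Unary.AllPairs using ([]; _∷_)
  open import Data.List.Relation.Unary.Unique.Propositional using (Unique)
  open import Data.List.Relation.Unary.Unique.Propositional.Properties using (filter⁺)
  open import Data.Nat
  open import Data.Nat.DivMod
  open import Data.Nat.Properties
  open import Data.Nat.Tactic.RingSolver using (solve-∀)
  open import Data.Product using (_,_)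
  open import Data.Rational as ℚ using (toℚᵘ)
  open import Data.Rational.Properties
    using (toℚᵘ-fromℚᵘ; toℚᵘ-cancel-≤; toℚᵘ-cancel-<; toℚᵘ-injective; toℚᵘ-homo-+; toℚᵘ-homo-*)
  open import Data.Rational.Unnormalised as ℚᵘ using (mkℚᵘ; *≡*; *≤*; *<*)
  import Data.Rational.Unnormalised.Properties as ℚᵘ
  open import Function using (_∘_)
  open import Relation.Binary.PropositionalEquality
  open import Relation.Nullary using (¬?; yes; no)

  Unique-bounded⇒length≤ : ∀ n {xs} → Unique xs → All (_< n) xs → length xs ≤ n
  Unique-bounded⇒length≤ zero    {[]}    _ _        = z≤n
  Unique-bounded⇒length≤ zero    {_ ∷ _} _ (() ∷ _)
  Unique-bounded⇒length≤ (suc n) {xs}    unique xs<1+n = begin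
    length xs                  ≤⟨ length≤1+length-remove unique ⟩
    suc (length (remove xs))   ≤⟨ s≤s (Unique-bounded⇒length≤ n (filter⁺ _ unique) remaining<n) ⟩
    suc n                      ∎
    where
    open ≤-Reasoning
    remove = filter (λ x → ¬? (x ≟ n))
    remaining<n : All (_< n) (remove xs)
    remaining<n = All.zipWith (λ (x<1+n , x≢n) → ≤∧≢⇒< (≤-pred x<1+n) x≢n)
                    (All-filter⁺ (λ x → ¬? (x ≟ n)) xs<1+n , all-filter (λ x → ¬? (x ≟ n)) xs)
    length≤1+length-remove : ∀ {ys} → Unique ys → length ys ≤ suc (length (remove ys))
    length≤1+length-remove {[]}     []              = z≤n
    length≤1+length-remove {y ∷ ys} (y∉ys ∷ unique) with y ≟ n
    ... | yes refl = s≤s (≤-reflexive (cong length (sym (trans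
                       (filter-reject (λ x → ¬? (x ≟ n)) (λ y≢y → y≢y refl))
                       (filter-all (λ x → ¬? (x ≟ n)) (All.map (λ y≢x → y≢x ∘ sym) y∉ys))))))
    ... | no  y≢n  = subst (λ zs → suc (length ys) ≤ suc (length zs)) (sym (filter-accept (λ x → ¬? (x ≟ n)) y≢n))
                       (s≤s (length≤1+length-remove unique))

  +≤3*[/]* : ∀ {a D} p .{{_ : NonZero p}} → a ≤ p → p ≤ D → a + D ≤ 3 * (D / p) * p
  +≤3*[/]* {a} {D} p a≤p p≤D = begin
    a + D               ≡⟨ cong (a +_) (m≡m%n+[m/n]*n D p) ⟩
    a + (D % p + C * p) ≤⟨ +-mono-≤ a≤p (+-monoˡ-≤ (C * p) (<⇒≤ (m%n<n D p))) ⟩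
    (2 + C) * p         ≤⟨ *-monoˡ-≤ p (+-mono-≤ 1≤C (+-mono-≤ 1≤C (≤-reflexive (sym (+-identityʳ C))))) ⟩
    3 * C * p           ∎
    where
    open ≤-Reasoning
    C = D / p
    1≤C : 1 ≤ C
    1≤C = m≥n⇒m/n>0 p≤D

  toℚᵘ-/ : ∀ m q → toℚᵘ ((ℤ.+ m) ℚ./ suc q) ℚᵘ.≃ mkℚᵘ (ℤ.+ m) q
  toℚᵘ-/ m q = toℚᵘ-fromℚᵘ (mkℚᵘ (ℤ.+ m) q)

  m≤k*n⇒m/n≤k : ∀ m k q → m ≤ k * suc q → (ℤ.+ m) ℚ./ suc q ℚ.≤ (ℤ.+ k) ℚ./ 1
  m≤k*n⇒m/n≤k m k q m≤kp =
    toℚᵘ-cancel-≤ (ℚᵘ.≤-respˡ-≃ (ℚᵘ.≃-sym (toℚᵘ-/ m q)) (ℚᵘ.≤-respʳ-≃ (ℚᵘ.≃-sym (toℚᵘ-/ k 0)) cross))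
    where
    cross : mkℚᵘ (ℤ.+ m) q ℚᵘ.≤ mkℚᵘ (ℤ.+ k) 0
    cross = *≤* (subst₂ ℤ._≤_ (ℤ.pos-* m 1) (ℤ.pos-* k (suc q))
                  (+≤+ (subst (_≤ k * suc q) (sym (*-identityʳ m)) m≤kp)))

  /1-homo-+ : ∀ a b → (ℤ.+ a) ℚ./ 1 ℚ.+ (ℤ.+ b) ℚ./ 1 ≡ (ℤ.+ (a + b)) ℚ./ 1
  /1-homo-+ a b = toℚᵘ-injective (begin
    toℚᵘ ((ℤ.+ a) ℚ./ 1 ℚ.+ (ℤ.+ b) ℚ./ 1)    ≈⟨ toℚᵘ-homo-+ ((ℤ.+ a) ℚ./ 1) ((ℤ.+ b) ℚ./ 1) ⟩
    toℚᵘ ((ℤ.+ a) ℚ./ 1) ℚᵘ.+ toℚᵘ ((ℤ.+ b) ℚ./ 1) ≈⟨ ℚᵘ.+-cong (toℚᵘ-/ a 0) (toℚᵘ-/ b 0) ⟩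
    mkℚᵘ (ℤ.+ a) 0 ℚᵘ.+ mkℚᵘ (ℤ.+ b) 0         ≈⟨ *≡* (trans (integer-identity (ℤ.+ a) (ℤ.+ b))
                                                           (cong (ℤ._* ℤ.+ 1) (sym (ℤ.pos-+ a b)))) ⟩
    mkℚᵘ (ℤ.+ (a + b)) 0                     ≈⟨ toℚᵘ-/ (a + b) 0 ⟨
    toℚᵘ ((ℤ.+ (a + b)) ℚ./ 1)               ∎)
    where
    open ℚᵘ.≃-Reasoning
    integer-identity : ∀ x y → (x ℤ.* ℤ.+ 1 ℤ.+ y ℤ.* ℤ.+ 1) ℤ.* ℤ.+ 1 ≡ (x ℤ.+ y) ℤ.* ℤ.+ 1
    integer-identity = ℤ-solve-∀

  3m<41/10*n : ∀ m n → m ≤ n → 1 ≤ n → (ℤ.+ (3 * m)) ℚ./ 1 ℚ.< ((ℤ.+ 41) ℚ./ 10) ℚ.* ((ℤ.+ n) ℚ./ 1)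
  3m<41/10*n m n m≤n 1≤n =
    toℚᵘ-cancel-< (ℚᵘ.<-respˡ-≃ (ℚᵘ.≃-sym (toℚᵘ-/ (3 * m) 0)) (ℚᵘ.<-respʳ-≃ (ℚᵘ.≃-sym product) cross))
    where
    product : toℚᵘ (((ℤ.+ 41) ℚ./ 10) ℚ.* ((ℤ.+ n) ℚ./ 1)) ℚᵘ.≃ mkℚᵘ (ℤ.+ 41) 9 ℚᵘ.* mkℚᵘ (ℤ.+ n) 0
    product = ℚᵘ.≃-trans (toℚᵘ-homo-* ((ℤ.+ 41) ℚ./ 10) ((ℤ.+ n) ℚ./ 1))
                (ℚᵘ.*-cong (toℚᵘ-/ 41 9) (toℚᵘ-/ n 0))
    30m<41n : 3 * m * 10 < 41 * n * 1
    30m<41n = begin-strict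
      3 * m * 10           ≤⟨ *-monoˡ-≤ 10 (*-monoʳ-≤ 3 m≤n) ⟩
      3 * n * 10           <⟨ m<m+n (3 * n * 10) (≤-trans 1≤n (m≤n*m n 11)) ⟩
      3 * n * 10 + 11 * n  ≡⟨ 30n+11n≡41n n ⟩
      41 * n * 1           ∎
      where
      open ≤-Reasoning
      30n+11n≡41n : ∀ n → 3 * n * 10 + 11 * n ≡ 41 * n * 1
      30n+11n≡41n = solve-∀
    cross : mkℚᵘ (ℤ.+ (3 * m)) 0 ℚᵘ.< mkℚᵘ (ℤ.+ 41) 9 ℚᵘ.* mkℚᵘ (ℤ.+ n) 0
    cross = *<* (subst₂ ℤ._<_ (ℤ.pos-* (3 * m) 10) (trans (ℤ.pos-* (41 * n) 1) (cong (ℤ._* ℤ.+ 1) (ℤ.pos-* 41 n)))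
                  (+<+ 30m<41n))


module LyndonRoots {k n : ℕ} (u : Vec (Fin k) n) where

  open import Defs
  open import Data.Bool using (Bool) renaming (_≟_ to _≟ᵇ_)
  open import Data.Bool.Properties using (¬-not)
  open import Data.Empty using (⊥; ⊥-elim)
  open import Data.Fin using (toℕ; fromℕ<)
  open import Data.Fin.Properties using (toℕ-injective; fromℕ<-cong)
  open import Data.Integer as ℤ using ()
  open import Data.List using (List; []; _∷_; length; map; upTo; _++_)
  open import Data.List.Membership.Propositional using (_∈_)
  open import Data.List.Membership.Propositional.Properties using (∈-++⁻)
  open import Data.List.Properties using (length-map; length-upTo; length-++)
  open import Data.List.Relation.Binary.Disjoint.Propositional using (Disjoint)
  open import Data.List.Relation.Unary.All as All using (All; []; _∷_)
  open import Data.List.Relation.Unary.All.Properties using (all-upTo) renaming (map⁺ to All-map⁺)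
  open import Data.List.Relation.Unary.AllPairs using ([]; _∷_)
  open import Data.List.Relation.Unary.Any using (here; there)
  open import Data.List.Relation.Unary.Unique.Propositional using (Unique)
  open import Data.List.Relation.Unary.Unique.Propositional.Properties using (map⁺; upTo⁺; ++⁺)
  open import Data.Nat hiding (less; equal; greater)
  open import Data.Nat.DivMod
  open import Data.Nat.Properties
  open import Algebra.Properties.CommutativeSemigroup +-commutativeSemigroup using (xy∙z≈xz∙y)
  open import Data.Product using (∃; _×_; _,_; proj₁; proj₂)
  open import Data.Rational as ℚ using ()
  import Data.Rational.Properties as ℚ
  open import Data.Sum using ([_,_])
  open import Data.Vec using (lookup)
  open import Function using (_∘_)
  open import Relation.Binary.Definitions using (tri<; tri≈; tri>)
  open import Relation.Binary.PropositionalEquality hiding ([_])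
  open import Relation.Nullary using (¬_; yes; no)
  open Lyndon
  open Bounds

  -- 0 outside the string; every use below is at a position known to be < n.
  letter : ℕ → ℕ
  letter t with t <? n
  ... | yes t<n = toℕ (lookup u (fromℕ< t<n))
  ... | no  _   = 0

  letter-lookup : ∀ {t} (t<n : t < n) → letter t ≡ toℕ (lookup u (fromℕ< t<n))
  letter-lookup {t} t<n with t <? n
  ... | yes t<n′ = cong (toℕ ∘ lookup u) (fromℕ<-cong t t refl t<n′ t<n)
  ... | no  t≮n  = ⊥-elim (t≮n t<n)

  CharEq⇒≡ : ∀ {a b} → CharEq u a b → letter a ≡ letter b
  CharEq⇒≡ (a<n , b<n , eq) = trans (letter-lookup a<n) (trans (cong toℕ eq) (sym (letter-lookup b<n)))

  ≡⇒CharEq : ∀ {a b} → a < n → b < n → letter a ≡ letter b → CharEq u a b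
  ≡⇒CharEq a<n b<n eq = a<n , b<n , toℕ-injective (trans (sym (letter-lookup a<n)) (trans eq (letter-lookup b<n)))

  record Run (i j p : ℕ) : Set where
    field
      j<n           : j < n
      1≤p           : 1 ≤ p
      2p≤length     : i + (p + p) ≤ suc j
      periodic      : ∀ t → i ≤ t → t + p ≤ j → letter t ≡ letter (t + p)
      shortest      : ∀ g → 1 ≤ g → g < p → ¬ (∀ t → i ≤ t → t + g ≤ j → letter t ≡ letter (t + g))
      left-maximal  : ∀ x → suc x ≡ i → letter x ≢ letter (x + p)
      right-maximal : suc j < n → letter (suc j ∸ p) ≢ letter (suc j)

  IsRunWithPeriod⇒Run : ∀ {i j p} → IsRunWithPeriod u i j p → Run i j p
  IsRunWithPeriod⇒Run {i} {j} {p} (i≤j , j<n , ((1≤p , per) , short) , 2p≤len , lmax , rmax) = record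
    { j<n           = j<n
    ; 1≤p           = 1≤p
    ; 2p≤length     = 2p≤length
    ; periodic      = λ t i≤t t+p≤j → CharEq⇒≡ (per t i≤t t+p≤j)
    ; shortest      = λ g 1≤g g<p g-periodic → short g 1≤g g<p (1≤g , λ t i≤t t+g≤j →
                        ≡⇒CharEq (in-string (≤-trans (m≤m+n t g) t+g≤j)) (in-string t+g≤j) (g-periodic t i≤t t+g≤j))
    ; left-maximal  = λ { x refl eq → lmax (s≤s z≤n)
                          (≡⇒CharEq (in-string (≤-trans (m≤m+n x p) (x+p≤j x refl))) (in-string (x+p≤j x refl)) eq) }
    ; right-maximal = λ 1+j<n eq → rmax 1+j<n (≡⇒CharEq (≤-<-trans (m∸n≤m (suc j) p) 1+j<n) 1+j<n eq)
    }
    where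
    in-string : ∀ {t} → t ≤ j → t < n
    in-string t≤j = ≤-<-trans t≤j j<n
    2p≤length : i + (p + p) ≤ suc j
    2p≤length = subst (i + (p + p) ≤_) (m+[n∸m]≡n (m≤n⇒m≤1+n i≤j))
                  (+-monoʳ-≤ i (subst (_≤ suc j ∸ i) (cong (p +_) (+-identityʳ p)) 2p≤len))
    x+p≤j : ∀ x → suc x ≡ i → x + p ≤ j
    x+p≤j x refl = ≤-pred (≤-trans (s≤s (+-monoʳ-≤ x (m≤m+n p p))) 2p≤length)

  -- The order of a run makes the letter following it smaller than the letter one period
  -- earlier (when the run ends the string the choice is immaterial).
  runOrder : ℕ → ℕ → Bool
  runOrder j p = orientation (letter (suc j)) (letter (suc j ∸ p))

  runOrder-correct : ∀ {i j p} → Run i j p → suc j < n → letter (suc j) <[ runOrder j p ] letter (suc j ∸ p)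
  runOrder-correct r 1+j<n = orientation-correct (Run.right-maximal r 1+j<n ∘ sym)

  -- Positions at which a run starts are excluded: this separates a run of period 1 from the
  -- runs passing through it.
  LyndonRoot : ℕ → ℕ → ℕ → ℕ → Set
  LyndonRoot i j p k = i < k × k + p ≤ suc j × Lyndon (runOrder j p) letter k p

  ¬starts-inside : ∀ {i j p i′ j′ k} → Run i j p → Run i′ j′ p → i < i′ → i′ ≤ k → k + p ≤ suc j → ⊥
  ¬starts-inside {p = p} {i′ = suc x} r r′ (s≤s i≤x) x<k k+p≤1+j =
    Run.left-maximal r′ x refl (Run.periodic r x i≤x (≤-pred (≤-trans (+-monoˡ-< p x<k) k+p≤1+j)))

  ¬ends-inside : ∀ {i j p i′ j′ k} → Run i j p → Run i′ j′ p → i′ ≤ k → k + p ≤ suc j → j < j′ → ⊥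
  ¬ends-inside {i} {j} {p} {i′} {j′} {k} r r′ i′≤k k+p≤1+j j<j′ =
    Run.right-maximal r (≤-<-trans j<j′ (Run.j<n r′))
      (trans (Run.periodic r′ y i′≤y y+p≤j′) (cong letter y+p≡1+j))
    where
    y = suc j ∸ p
    y+p≡1+j : y + p ≡ suc j
    y+p≡1+j = m∸n+n≡m (≤-trans (m≤n+m p k) k+p≤1+j)
    i′≤y : i′ ≤ y
    i′≤y = ≤-trans i′≤k (subst (_≤ y) (m+n∸n≡m k p) (∸-monoˡ-≤ p k+p≤1+j))
    y+p≤j′ : y + p ≤ j′
    y+p≤j′ = subst (_≤ j′) (sym y+p≡1+j) j<j′

  runs-sharing-window : ∀ {i j p i′ j′ k} → Run i j p → Run i′ j′ p
    → i ≤ k → k + p ≤ suc j → i′ ≤ k → k + p ≤ suc j′ → i ≡ i′ × j ≡ j′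
  runs-sharing-window r r′ i≤k k+p≤1+j i′≤k k+p≤1+j′ =
    ≤-antisym (≮⇒≥ λ i′<i → ¬starts-inside r′ r i′<i i≤k k+p≤1+j′)
              (≮⇒≥ λ i<i′ → ¬starts-inside r r′ i<i′ i′≤k k+p≤1+j) ,
    ≤-antisym (≮⇒≥ λ j′<j → ¬ends-inside r′ r i≤k k+p≤1+j′ j′<j)
              (≮⇒≥ λ j<j′ → ¬ends-inside r r′ i′≤k k+p≤1+j j<j′)

  -- Compare the extension with the run's own continuation: the first mismatch is either inside
  -- the run (contradicting periodicity) or at the letter after the run, which is smaller.
  Lyndon-root-maximal : ∀ {i j p k g} → Run i j p → i ≤ k → k + p ≤ suc j → 1 ≤ g → k + (p + g) ≤ n
    → ¬ Lyndon (runOrder j p) letter k (p + g)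
  Lyndon-root-maximal {i} {j} {p} {k} {g} r i≤k k+p≤1+j 1≤g fits lyndon =
    versus-run (lyndon p g (Run.1≤p r) 1≤g refl)
    where
    o = runOrder j p
    t = suc j ∸ (k + p)
    k+p+t≡1+j : k + p + t ≡ suc j
    k+p+t≡1+j = m+[n∸m]≡n k+p≤1+j
    k+t≡1+j∸p : k + t ≡ suc j ∸ p
    k+t≡1+j∸p = sym (trans (cong (_∸ p) (trans (sym k+p+t≡1+j) (xy∙z≈xz∙y k p t))) (m+n∸n≡m (k + t) p))
    1+j<n : t < g → suc j < n
    1+j<n t<g = subst (_< n) k+p+t≡1+j (<-≤-trans (+-monoʳ-< (k + p) t<g) (subst (_≤ n) (sym (+-assoc k p g)) fits))
    versus-run : ¬ LexLess o letter k (k + p) g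
    versus-run (lex e e<g ag l) with <-cmp t e
    ... | tri< t<e _ _ = Run.right-maximal r (1+j<n (<-trans t<e e<g))
                           (trans (cong letter (sym k+t≡1+j∸p)) (trans (ag t t<e) (cong letter k+p+t≡1+j)))
    ... | tri≈ _ refl _ = <[]-asym o (runOrder-correct r (1+j<n e<g))
                            (subst₂ (_<[ o ]_) (cong letter k+t≡1+j∸p) (cong letter k+p+t≡1+j) l)
    ... | tri> _ _ e<t = <[]-irrefl o (trans (Run.periodic r (k + e) (≤-trans i≤k (m≤m+n k e)) k+e+p≤j)
                           (cong letter (xy∙z≈xz∙y k e p))) l
      where
      k+e+p≤j : k + e + p ≤ j
      k+e+p≤j = ≤-pred (subst (_≤ suc j) (cong suc (xy∙z≈xz∙y k p e))
                  (subst (suc (k + p + e) ≤_) k+p+t≡1+j (+-monoʳ-< (k + p) e<t)))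

  -- The letter before k lies in both runs, so the longer root would begin and end with the same letter.
  ¬period-one-root-and-longer : ∀ {i j i′ j′ m k} → Run i j 1 → LyndonRoot i j 1 k
    → Run i′ j′ (2 + m) → ¬ LyndonRoot i′ j′ (2 + m) k
  ¬period-one-root-and-longer {m = m} {k = suc x}
    r (s≤s i≤x , x+2≤1+j , _) r′ (s≤s i′≤x , k+p≤1+j′ , lyndon′) =
    <[]-irrefl _ (begin
      letter (suc x)             ≡⟨ cong letter (+-comm 1 x) ⟩
      letter (x + 1)             ≡⟨ Run.periodic r x i≤x (≤-pred x+2≤1+j) ⟨
      letter x                   ≡⟨ Run.periodic r′ x i′≤x (≤-pred k+p≤1+j′) ⟩
      letter (x + (2 + m))       ≡⟨ cong letter (+-suc x (suc m)) ⟩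
      letter (suc x + suc m)     ∎)
    (Lyndon⇒first<last _ m lyndon′)
    where open ≡-Reasoning

  shorter-Lyndon-root-impossible : ∀ {i j p i′ j′ p′ k} → Run i j p → LyndonRoot i j p k
    → Run i′ j′ p′ → LyndonRoot i′ j′ p′ k → ¬ p < p′
  shorter-Lyndon-root-impossible {p = zero} r _ _ _ _ = 1+n≰n (Run.1≤p r)
  shorter-Lyndon-root-impossible {p = suc zero} {p′ = suc zero} _ _ _ _ (s≤s ())
  shorter-Lyndon-root-impossible {p = suc zero} {p′ = suc (suc _)} r root r′ root′ _ =
    ¬period-one-root-and-longer r root r′ root′
  shorter-Lyndon-root-impossible {j = j} {p = p@(suc (suc m))} {j′ = j′} {k = k}
    r (i<k , k+p≤1+j , lyndon) r′ (_ , k+p′≤1+j′ , lyndon′) p<p′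
    with m≤n⇒∃[o]m+o≡n p<p′
  ... | g , refl with runOrder j′ (suc p + g) ≟ᵇ runOrder j p
  ...   | yes same =
    Lyndon-root-maximal r (<⇒≤ i<k) k+p≤1+j (s≤s z≤n) fits
      (subst₂ (λ o ℓ → Lyndon o letter k ℓ) same (sym (+-suc p g)) lyndon′)
    where
    fits : k + (p + suc g) ≤ n
    fits = subst (λ ℓ → k + ℓ ≤ n) (sym (+-suc p g)) (≤-trans k+p′≤1+j′ (Run.j<n r′))
  ...   | no differ =
    Lyndon-unique-order (runOrder j p) m (suc (m + g)) lyndon (subst (λ o → Lyndon o letter k _) (¬-not differ) lyndon′)

  LyndonRoot-determines-run : ∀ {i j p i′ j′ p′ k} → Run i j p → LyndonRoot i j p k
    → Run i′ j′ p′ → LyndonRoot i′ j′ p′ k → (i , j , p) ≡ (i′ , j′ , p′)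
  LyndonRoot-determines-run r root r′ root′
    with ≤-antisym (≮⇒≥ (shorter-Lyndon-root-impossible r′ root′ r root))
                   (≮⇒≥ (shorter-Lyndon-root-impossible r root r′ root′))
  ... | refl with runs-sharing-window r r′ (<⇒≤ (proj₁ root)) (proj₁ (proj₂ root))
                                          (<⇒≤ (proj₁ root′)) (proj₁ (proj₂ root′))
  ...   | refl , refl = refl

  LyndonRoot⇒<n : ∀ {i j p k} → Run i j p → LyndonRoot i j p k → k < n
  LyndonRoot⇒<n {k = k} r (_ , k+p≤1+j , _) = <-≤-trans (m<m+n k (Run.1≤p r)) (≤-trans k+p≤1+j (Run.j<n r))

  RootsBound : ℕ → ℕ → ℕ → Set
  RootsBound i j p = ∃ λ ks → Unique ks × All (LyndonRoot i j p) ks × suc j ∸ i ≤ 3 * length ks * p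

  -- Inside the run the string is the periodic extension of its first period; a Lyndon rotation
  -- of that period and all its translates by multiples of p that fit are Lyndon roots.
  module _ {i j q : ℕ} (r : Run i j (suc q)) where

    private
      p = suc q
      o = runOrder j p
      ω = cycle (λ s → letter (i + s)) p

    run-periodic-iterated : ∀ x c → i ≤ x → x + c * p ≤ j → letter (x + c * p) ≡ letter x
    run-periodic-iterated x zero    _   _     = cong letter (+-identityʳ x)
    run-periodic-iterated x (suc c) i≤x bound = begin
      letter (x + (p + c * p)) ≡⟨ cong letter shift ⟩
      letter (x + c * p + p)   ≡⟨ Run.periodic r (x + c * p) (≤-trans i≤x (m≤m+n x (c * p))) bound′ ⟨
      letter (x + c * p)       ≡⟨ run-periodic-iterated x c i≤x (≤-trans (m≤m+n (x + c * p) p) bound′) ⟩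
      letter x                 ∎
      where
      open ≡-Reasoning
      shift : x + (p + c * p) ≡ x + c * p + p
      shift = trans (cong (x +_) (+-comm p (c * p))) (sym (+-assoc x (c * p) p))
      bound′ : x + c * p + p ≤ j
      bound′ = subst (_≤ j) shift bound

    run≡cycle : ∀ t → i + t ≤ j → letter (i + t) ≡ ω t
    run≡cycle t i+t≤j = trans (cong letter split)
      (run-periodic-iterated (i + t % p) (t / p) (m≤m+n i (t % p)) (subst (_≤ j) split i+t≤j))
      where
      split : i + t ≡ i + t % p + t / p * p
      split = trans (cong (i +_) (m≡m%n+[m/n]*n t p)) (sym (+-assoc i (t % p) (t / p * p)))

    cycle-primitive : ∀ g → 1 ≤ g → g < p → ¬ (∀ t → ω t ≡ ω (t + g))
    cycle-primitive g 1≤g g<p shift = Run.shortest r g 1≤g g<p run-shift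
      where
      run-shift : ∀ t → i ≤ t → t + g ≤ j → letter t ≡ letter (t + g)
      run-shift t i≤t t+g≤j with m≤n⇒∃[o]m+o≡n i≤t
      ... | s , refl = begin
        letter (i + s)       ≡⟨ run≡cycle s (≤-trans (m≤m+n (i + s) g) t+g≤j) ⟩
        ω s                  ≡⟨ shift s ⟩
        ω (s + g)            ≡⟨ run≡cycle (s + g) (subst (_≤ j) (+-assoc i s g) t+g≤j) ⟨
        letter (i + (s + g)) ≡⟨ cong letter (+-assoc i s g) ⟨
        letter (i + s + g)   ∎
        where open ≡-Reasoning

    Run-Lyndon-roots : RootsBound i j p
    Run-Lyndon-roots = translates rotation
      where
      rotation : ∃ λ a → 1 ≤ a × a ≤ p × Lyndon o ω a p
      rotation = primitive-cycle-Lyndon-rotation o (λ s → letter (i + s)) q cycle-primitive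
      translates : (∃ λ a → 1 ≤ a × a ≤ p × Lyndon o ω a p) → RootsBound i j p
      translates (a , 1≤a , a≤p , lyndon) =
        roots , unique , all-roots , subst (λ ℓ → suc j ∸ i ≤ 3 * ℓ * p) (sym length-roots) length-bound
        where
        D = suc j ∸ (i + a)
        C = D / p
        root : ℕ → ℕ
        root c = i + a + c * p
        roots = map root (upTo C)

        i+a+p≤1+j : i + a + p ≤ suc j
        i+a+p≤1+j = ≤-trans (≤-reflexive (+-assoc i a p))
                      (≤-trans (+-monoʳ-≤ i (+-monoˡ-≤ p a≤p)) (Run.2p≤length r))
        i+a+D≡1+j : i + a + D ≡ suc j
        i+a+D≡1+j = m+[n∸m]≡n (≤-trans (m≤m+n (i + a) p) i+a+p≤1+j)
        p≤D : p ≤ D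
        p≤D = m+n≤o⇒m≤o∸n p (subst (_≤ suc j) (+-comm (i + a) p) i+a+p≤1+j)

        root-fits : ∀ {c} → c < C → root c + p ≤ suc j
        root-fits {c} c<C = begin
          i + a + c * p + p   ≡⟨ +-assoc (i + a) (c * p) p ⟩
          i + a + (c * p + p) ≡⟨ cong (i + a +_) (+-comm (c * p) p) ⟩
          i + a + suc c * p   ≤⟨ +-monoʳ-≤ (i + a) (≤-trans (*-monoˡ-≤ p c<C) (m/n*n≤m D p)) ⟩
          i + a + D           ≡⟨ i+a+D≡1+j ⟩
          suc j               ∎
          where open ≤-Reasoning

        root-is-Lyndon : ∀ {c} → c < C → Lyndon o letter (root c) p
        root-is-Lyndon {c} c<C = Lyndon-transport o agreeing lyndon
          where
          agreeing : ∀ t → t < p → ω (a + t) ≡ letter (root c + t)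
          agreeing t t<p = begin
            ω (a + t)                   ≡⟨ cycle-periodic (λ s → letter (i + s)) p (a + t) c ⟨
            ω (a + t + c * p)           ≡⟨ run≡cycle (a + t + c * p) (subst (_≤ j) (sym regroup) (≤-pred inside)) ⟨
            letter (i + (a + t + c * p)) ≡⟨ cong letter regroup ⟩
            letter (root c + t)         ∎
            where
            open ≡-Reasoning
            regroup : i + (a + t + c * p) ≡ root c + t
            regroup = trans (sym (+-assoc i (a + t) (c * p)))
                        (trans (cong (_+ c * p) (sym (+-assoc i a t))) (xy∙z≈xz∙y (i + a) t (c * p)))
            inside : root c + t < suc j
            inside = <-≤-trans (+-monoʳ-< (root c) t<p) (root-fits c<C)

        all-roots : All (LyndonRoot i j p) roots
        all-roots = All-map⁺ (All.map (λ {c} c<C → i<root c , root-fits c<C , root-is-Lyndon c<C) (all-upTo C))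
          where
          i<root : ∀ c → i < root c
          i<root c = <-≤-trans (m<m+n i 1≤a) (m≤m+n (i + a) (c * p))

        unique : Unique roots
        unique = map⁺ (λ {c} {c′} eq → *-cancelʳ-≡ c c′ p (+-cancelˡ-≡ (i + a) (c * p) (c′ * p) eq)) (upTo⁺ C)

        length-roots : length roots ≡ C
        length-roots = trans (length-map root (upTo C)) (length-upTo C)

        length-bound : suc j ∸ i ≤ 3 * C * p
        length-bound = subst (_≤ 3 * C * p) (sym 1+j∸i≡a+D) (+≤3*[/]* p a≤p p≤D)
          where
          1+j∸i≡a+D : suc j ∸ i ≡ a + D
          1+j∸i≡a+D = trans (cong (_∸ i) (trans (sym i+a+D≡1+j) (+-assoc i a D))) (m+n∸m≡n i (a + D))

  IsRun : ℕ × ℕ × ℕ → Set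
  IsRun (i , j , p) = Run i j p

  RootOf : ℕ × ℕ × ℕ → ℕ → Set
  RootOf (i , j , p) = LyndonRoot i j p

  exponent≤3*#roots : ∀ r → IsRun r
    → ∃ λ ks → Unique ks × All (RootOf r) ks × exponent r ℚ.≤ (ℤ.+ (3 * length ks)) ℚ./ 1
  exponent≤3*#roots (i , j , zero)  r = ⊥-elim (1+n≰n (Run.1≤p r))
  exponent≤3*#roots (i , j , suc q) r =
    let ks , unique , roots , bound = Run-Lyndon-roots r
    in ks , unique , roots , m≤k*n⇒m/n≤k (suc j ∸ i) (3 * length ks) q bound

  RootOf-determines-run : ∀ r r′ {k} → IsRun r → RootOf r k → IsRun r′ → RootOf r′ k → r ≡ r′
  RootOf-determines-run (i , j , p) (i′ , j′ , p′) = LyndonRoot-determines-run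

  RootOf⇒<n : ∀ r {k} → IsRun r → RootOf r k → k < n
  RootOf⇒<n (i , j , p) = LyndonRoot⇒<n

  ExponentsBoundedByRoots : List (ℕ × ℕ × ℕ) → Set
  ExponentsBoundedByRoots rs = ∃ λ ks → Unique ks × (∀ {k} → k ∈ ks → ∃ λ r → r ∈ rs × RootOf r k)
                                        × sumℚ (map exponent rs) ℚ.≤ (ℤ.+ (3 * length ks)) ℚ./ 1

  sum-exponents≤3*#roots : ∀ rs → Unique rs → All IsRun rs → ExponentsBoundedByRoots rs
  sum-exponents≤3*#roots []       []                  []           = [] , [] , (λ ()) , ℚ.≤-refl
  sum-exponents≤3*#roots (r ∷ rs) (r∉rs ∷ unique-rs) (run ∷ runs) =
    add (exponent≤3*#roots r run) (sum-exponents≤3*#roots rs unique-rs runs)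
    where
    add : (∃ λ ks → Unique ks × All (RootOf r) ks × exponent r ℚ.≤ (ℤ.+ (3 * length ks)) ℚ./ 1)
        → ExponentsBoundedByRoots rs → ExponentsBoundedByRoots (r ∷ rs)
    add (ks , unique , roots , bound) (ks′ , unique′ , roots′ , bound′) =
      ks ++ ks′ , ++⁺ unique unique′ disjoint , root-of , sum-bound
      where
      disjoint : Disjoint ks ks′
      disjoint (k∈ks , k∈ks′) =
        let r′ , r′∈rs , root′ = roots′ k∈ks′
        in All.lookup r∉rs r′∈rs
             (RootOf-determines-run r r′ run (All.lookup roots k∈ks) (All.lookup runs r′∈rs) root′)
      root-of : ∀ {k} → k ∈ ks ++ ks′ → ∃ λ r′ → r′ ∈ r ∷ rs × RootOf r′ k
      root-of k∈ = [ (λ k∈ks → r , here refl , All.lookup roots k∈ks)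
                   , (λ k∈ks′ → let r′ , r′∈rs , root′ = roots′ k∈ks′ in r′ , there r′∈rs , root′)
                   ] (∈-++⁻ ks k∈)
      sum-bound : sumℚ (map exponent (r ∷ rs)) ℚ.≤ (ℤ.+ (3 * length (ks ++ ks′))) ℚ./ 1
      sum-bound = ℚ.≤-trans (ℚ.+-mono-≤ bound bound′)
                    (ℚ.≤-reflexive (trans (/1-homo-+ (3 * length ks) (3 * length ks′)) (cong (λ m → (ℤ.+ m) ℚ./ 1) 3*length)))
        where
        3*length : 3 * length ks + 3 * length ks′ ≡ 3 * length (ks ++ ks′)
        3*length = trans (sym (*-distribˡ-+ 3 (length ks) (length ks′))) (cong (3 *_) (sym (length-++ ks)))


open import Defs
open import Data.Nat using (_≤_)
open import Data.Product using (_×_; _,_)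
open import Data.List using (List; map)
open import Data.List.Membership.Propositional using (_∈_)
open import Data.List.Relation.Unary.Unique.Propositional using (Unique)
open import Data.Integer using (+_)
open import Data.Rational using (_/_; _<_; _*_)
open import Function.Bundles using (_⇔_)

open import Data.List using (length)
open import Data.List.Relation.Unary.All as All using (All)
open import Data.Rational.Properties using (≤-<-trans)
open import Function.Bundles using (module Equivalence)
open LyndonRoots using (IsRunWithPeriod⇒Run; IsRun; RootOf⇒<n; sum-exponents≤3*#roots)
open Bounds using (Unique-bounded⇒length≤; 3m<41/10*n)

theorem2 : (k n : ℕ) → 1 ≤ n → (u : Vec (Fin k) n)
    → (runs : List (ℕ × ℕ × ℕ)) → Unique runs
    → (∀ i j p → ((i , j , p) ∈ runs) ⇔ IsRunWithPeriod u i j p)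
    → sumℚ (map exponent runs) < ((+ 41) / 10) * ((+ n) / 1)
theorem2 k n 1≤n u runs unique runs⇔ =
  let roots , unique-roots , root-of , sum≤3*#roots = sum-exponents≤3*#roots u runs unique all-runs
      roots<n = All.tabulate λ k∈roots →
                  let r , r∈runs , root = root-of k∈roots in RootOf⇒<n u r (All.lookup all-runs r∈runs) root
  in ≤-<-trans sum≤3*#roots (3m<41/10*n (length roots) n (Unique-bounded⇒length≤ n unique-roots roots<n) 1≤n)
  where
  all-runs : All (IsRun u) runs
  all-runs = All.tabulate λ { {i , j , p} r∈runs → IsRunWithPeriod⇒Run u (Equivalence.to (runs⇔ i j p) r∈runs) }
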